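{- Let $E$ be a finite set. For every Lagrangian subspace $L\subset V_E$, the set system $\nu_E(L)=(E;\Psi_L)$, where $\Psi_L=\{Y\subset E: L\cap\langle Y^\vee\sqcup(E\setminus Y)\rangle=0\}$, is a binary delta-matroid on $E$.
   Context: Let $E^\vee$ be a disjoint copy of $E$, with $e^\vee$ the copy of $e$; $Y^\vee=\{e^\vee:e\in Y\}$. $V_E$ is the $\mathbb{F}_2$-vector space with basis $E\sqcup E^\vee$ and symplectic form given on basis vectors by $(e,e^\vee)=(e^\vee,e)=1$ and $0$ on all other pairs of basis vectors; a Lagrangian subspace is an isotropic subspace of dimension $|E|$; angle brackets denote span. A framed graph is a simple graph with frames in $\mathbb{F}_2$ on vertices; its adjacency matrix over $\mathbb{F}_2$ has off-diagonal entries $1$ exactly for adjacent pairs and diagonal entries equal to the frames; $G$ is non-degenerate if this determinant is $1$ (empty graph counts as non-degenerate). The non-degeneracy delta-matroid of $G$ is $(V(G);\Phi(G))$, $\Phi(G)=\{U\subset V(G): G_U\text{ non-degenerate}\}$, $G_U$ the induced subgraph. The twist of a set system is $(E;\Phi)*E'=(E;\{\phi\,\Delta\,E':\phi\in\Phi\})$. A binary delta-matroid on $E$ is a set system $(E;\Phi(G))*E'$ for a framed graph $G$ with vertex set $E$ and some $E'\subset E$. -}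

module Defs where

open import Data.Nat using (ℕ; zero; suc)
open import Data.Bool using (Bool; true; false; _xor_; _∧_; if_then_else_)
open import Data.Fin using (Fin; zero; suc; punchIn)
open import Data.Fin.Subset using (Subset)
open import Data.Vec using (Vec; lookup; zipWith)
open import Data.List using (List; []; _∷_; length)
import Data.List as List
open import Data.Product using (_×_; _,_; proj₁; proj₂; ∃)
open import Relation.Binary.PropositionalEquality using (_≡_)
open import Function.Bundles using (_⇔_)

-- Ground set E = Fin n.  F₂ = Bool (xor = +, ∧ = ·).

⊕ : (k : ℕ) → (Fin k → Bool) → Bool
⊕ zero    f = false
⊕ (suc k) f = f zero xor ⊕ k (λ i → f (suc i))

-- V_E : a vector is given by its coefficients on the basis E (first
-- component) and on the basis E^∨ (second component).
V : ℕ → Set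
V n = (Fin n → Bool) × (Fin n → Bool)

_+V_ : ∀ {n} → V n → V n → V n
(x , x') +V (y , y') = (λ e → x e xor y e) , (λ e → x' e xor y' e)

zeroV : ∀ {n} → V n
zeroV = (λ _ → false) , (λ _ → false)

IsZero : ∀ {n} → V n → Set
IsZero (x , x') = ∀ e → (x e ≡ false) × (x' e ≡ false)

form : ∀ {n} → V n → V n → Bool
form {n} (x , x') (y , y') = ⊕ n (λ e → (x e ∧ y' e) xor (x' e ∧ y e))

comb : ∀ {n k} → (Fin k → V n) → (Fin k → Bool) → V n
comb {n} {k} b a =
  (λ e → ⊕ k (λ i → a i ∧ proj₁ (b i) e)) ,
  (λ e → ⊕ k (λ i → a i ∧ proj₂ (b i) e))

-- A Lagrangian subspace L ⊂ V_E (dim V_E = 2n) is an isotropic subspace of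
-- dimension n; we present it by a basis of n linearly independent vectors,
-- L being their span {comb basis a}.
record Lagrangian (n : ℕ) : Set where
  field
    basis       : Fin n → V n
    independent : ∀ a → IsZero (comb basis a) → ∀ i → a i ≡ false
    isotropic   : ∀ a c → form (comb basis a) (comb basis c) ≡ false

-- membership in the span ⟨Y^∨ ⊔ (E∖Y)⟩: the subspace spanned by the basis
-- vectors e^∨ (e ∈ Y) and e (e ∉ Y), i.e. vectors whose e-coefficient
-- vanishes for e ∈ Y and whose e^∨-coefficient vanishes for e ∉ Y.
InSpanYdualCompl : ∀ {n} → Subset n → V n → Set
InSpanYdualCompl Y (x , x') =
  ∀ e → (if lookup Y e then x e ≡ false else x' e ≡ false)

InΨ : ∀ {n} → Lagrangian n → Subset n → Set
InΨ L Y = ∀ a → InSpanYdualCompl Y (comb (Lagrangian.basis L) a)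
              → IsZero (comb (Lagrangian.basis L) a)

-- Determinant over F₂ of a k×k matrix (Laplace expansion along the
-- first row; signs are irrelevant in characteristic 2). det of the 0×0
-- matrix is 1.
det : (k : ℕ) → (Fin k → Fin k → Bool) → Bool
det zero    M = true
det (suc k) M = ⊕ (suc k) (λ j → M zero j ∧ det k (λ r c → M (suc r) (punchIn j c)))

-- A framed graph on vertex set Fin n, given by its F₂-adjacency matrix:
-- symmetric, off-diagonal entries = adjacency, diagonal entries = frames.
record FramedGraph (n : ℕ) : Set where
  field
    adj : Fin n → Fin n → Bool
    sym : ∀ i j → adj i j ≡ adj j i

elems : ∀ {n} → Subset n → List (Fin n)
elems {n} U = List.filterᵇ (lookup U) (List.allFin n)

inducedMatrix : ∀ {n} → FramedGraph n → (U : Subset n)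
  → Fin (length (elems U)) → Fin (length (elems U)) → Bool
inducedMatrix G U i j =
  FramedGraph.adj G (List.lookup (elems U) i) (List.lookup (elems U) j)

NonDegenerate : ∀ {n} → FramedGraph n → Subset n → Set
NonDegenerate G U = det (length (elems U)) (inducedMatrix G U) ≡ true

InΦ : ∀ {n} → FramedGraph n → Subset n → Set
InΦ G U = NonDegenerate G U

_Δ_ : ∀ {n} → Subset n → Subset n → Subset n
_Δ_ = zipWith _xor_

-- The set system (E ; P) (P a predicate on subsets) is a binary
-- delta-matroid: it equals (E;Φ(G)) * E' for some framed graph G on E and
-- E' ⊂ E, i.e. P = {φ Δ E' : φ ∈ Φ(G)}.
IsBinaryDeltaMatroid : ∀ {n} → (Subset n → Set) → Set
IsBinaryDeltaMatroid {n} P =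
  ∃ λ (G : FramedGraph n) → ∃ λ (E' : Subset n) →
    ∀ Y → P Y ⇔ ∃ (λ φ → InΦ G φ × (Y ≡ φ Δ E'))

-- A Lagrangian L ⊂ V_E is transversal to some coordinate Lagrangian
-- ⟨Y₀^∨ ⊔ (E∖Y₀)⟩: by induction on |E|, pivoting on a basis vector with a
-- nonzero coordinate at e₀ or e₀^∨ (or dropping e₀ if there is none).  Relative
-- to such Y₀, L is the graph of a matrix A expressing the complementary
-- coordinates of its vectors through the Y₀-coordinates, and A is symmetric
-- because L is isotropic.  Moving from Y₀ to Y exchanges the roles of the two
-- coordinates exactly on Y Δ Y₀, so L ∩ ⟨Y^∨ ⊔ (E∖Y)⟩ = 0 iff the principal
-- submatrix of A on Y Δ Y₀ has trivial kernel, i.e. is non-degenerate.  Hence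
-- Ψ_L = Φ(G) * Y₀ for the framed graph G with adjacency matrix A.  Over F₂ the
-- Laplace-expansion determinant detects trivial kernels, which is proved by
-- pivoting with Schur complements.

module Submission where

open import Defs
open import Data.Nat using (ℕ; zero; suc; _+_; _≤_; _<_; s≤s)
import Data.Nat.Properties as ℕ
open import Data.Bool using (Bool; true; false; _xor_; _∧_; if_then_else_; not; T?)
import Data.Bool.Properties as Bool
open import Data.Bool.Properties
  using (¬-not; ∧-comm; ∧-assoc; ∧-identityʳ; ∧-zeroʳ; xor-comm; xor-assoc; xor-identityʳ; xor-same;
         ∧-distribˡ-xor; ∧-distribʳ-xor; xor-∧-commutativeRing)
open import Data.Fin using (Fin; zero; suc; punchIn; punchOut; inject₁; toℕ)
open import Data.Vec.Functional using (insertAt; _∷_)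
open import Data.Vec.Functional.Properties using (insertAt-lookup; insertAt-punchIn)
open import Data.Fin.Properties
  using (any?; punchInᵢ≢i; punchIn-punchOut; punchIn-injective; suc-injective; toℕ-injective; toℕ-inject₁)
  renaming (_≟_ to _≟ᶠ_)
open import Data.Fin.Subset using (Subset)
open import Data.Vec using (lookup; tabulate)
import Data.Vec as Vec
open import Data.Vec.Properties using (lookup-zipWith; lookup∘tabulate)
open import Data.List using (List; length; allFin)
import Data.List as List
open import Data.List.Relation.Unary.All as All using ()
open import Data.List.Relation.Unary.Any as Any using ()
open import Data.List.Relation.Unary.Any.Properties using (lookup-index)
import Data.List.Relation.Unary.AllPairs as AllPairs
open import Data.List.Relation.Unary.Unique.Propositional using (Unique)
import Data.List.Relation.Unary.Unique.Propositional.Properties as Unique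
open import Data.List.Membership.Propositional.Properties using (∈-lookup; ∈-allFin; ∈-filter⁺; ∈-filter⁻)
open import Data.Product using (Σ; _×_; _,_; proj₁; proj₂)
open import Data.Sum using (_⊎_; inj₁; inj₂)
open import Data.Empty using (⊥-elim)
open import Relation.Binary.Definitions using (tri<; tri≈; tri>)
open import Relation.Binary.PropositionalEquality
open import Relation.Nullary using (yes; no; does; ¬?; _×-dec_)
open import Relation.Nullary.Decidable using (dec-true; dec-false)
open import Function using (_∘_; case_of_)
open import Function.Bundles using (_⇔_; mk⇔; Equivalence)
import Function.Properties.Equivalence as ⇔
import Algebra.Properties.CommutativeSemigroup as CommSemigroupProperties
open import Algebra.Bundles using (CommutativeRing)

open CommSemigroupProperties (CommutativeRing.+-commutativeSemigroup xor-∧-commutativeRing)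
  using () renaming (interchange to xor-interchange; x∙yz≈y∙xz to xor-leftComm)
open CommSemigroupProperties (CommutativeRing.*-commutativeSemigroup xor-∧-commutativeRing)
  using () renaming (x∙yz≈yx∙z to ∧-rotate)

-- Sums over F₂

xor≡false⇒≡ : ∀ a b → a xor b ≡ false → a ≡ b
xor≡false⇒≡ false false _ = refl
xor≡false⇒≡ true  true  _ = refl

xor-cancelʳ : ∀ u w → (u xor w) xor w ≡ u
xor-cancelʳ u w = trans (xor-assoc u w w) (trans (cong (u xor_) (xor-same w)) (xor-identityʳ u))

Vanishes : ∀ {k} → (Fin k → Bool) → Set
Vanishes f = ∀ i → f i ≡ false

Nonzero : ∀ {k} → (Fin k → Bool) → Set
Nonzero {k} x = Σ (Fin k) λ j → x j ≡ true

someTrue? : ∀ {k} (f : Fin k → Bool) → Nonzero f ⊎ Vanishes f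
someTrue? f with any? (λ i → f i Bool.≟ true)
... | yes nonzero = inj₁ nonzero
... | no  none    = inj₂ (λ i → ¬-not (λ fi → none (i , fi)))

≗-via-punchIn : ∀ {k} {A : Set} p {f g : Fin (suc k) → A} → f p ≡ g p →
  (∀ c → f (punchIn p c) ≡ g (punchIn p c)) → ∀ i → f i ≡ g i
≗-via-punchIn p {f} {g} fp≡gp f≗g i with i ≟ᶠ p
... | yes refl = fp≡gp
... | no i≢p   = subst (λ j → f j ≡ g j) (punchIn-punchOut (i≢p ∘ sym)) (f≗g (punchOut (i≢p ∘ sym)))

⊕-cong : ∀ k {f g : Fin k → Bool} → (∀ i → f i ≡ g i) → ⊕ k f ≡ ⊕ k g
⊕-cong zero    f≗g = refl
⊕-cong (suc k) f≗g = cong₂ _xor_ (f≗g zero) (⊕-cong k (f≗g ∘ suc))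

⊕-vanishes : ∀ k {f : Fin k → Bool} → Vanishes f → ⊕ k f ≡ false
⊕-vanishes zero    f≗0 = refl
⊕-vanishes (suc k) f≗0 rewrite f≗0 zero = ⊕-vanishes k (f≗0 ∘ suc)

⊕-distrib-xor : ∀ k (f g : Fin k → Bool) → ⊕ k (λ i → f i xor g i) ≡ ⊕ k f xor ⊕ k g
⊕-distrib-xor zero    f g = refl
⊕-distrib-xor (suc k) f g =
  trans (cong ((f zero xor g zero) xor_) (⊕-distrib-xor k (f ∘ suc) (g ∘ suc)))
        (xor-interchange (f zero) (g zero) _ _)

∧-distribˡ-⊕ : ∀ k b (f : Fin k → Bool) → b ∧ ⊕ k f ≡ ⊕ k (λ i → b ∧ f i)
∧-distribˡ-⊕ zero    b f = ∧-zeroʳ b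
∧-distribˡ-⊕ (suc k) b f =
  trans (∧-distribˡ-xor b (f zero) _) (cong ((b ∧ f zero) xor_) (∧-distribˡ-⊕ k b (f ∘ suc)))

∧-distribʳ-⊕ : ∀ k b (f : Fin k → Bool) → ⊕ k f ∧ b ≡ ⊕ k (λ i → f i ∧ b)
∧-distribʳ-⊕ k b f =
  trans (∧-comm (⊕ k f) b) (trans (∧-distribˡ-⊕ k b f) (⊕-cong k (λ i → ∧-comm b (f i))))

⊕-punchIn : ∀ k p (f : Fin (suc k) → Bool) → ⊕ (suc k) f ≡ f p xor ⊕ k (f ∘ punchIn p)
⊕-punchIn k       zero    f = refl
⊕-punchIn (suc k) (suc p) f =
  trans (cong (f zero xor_) (⊕-punchIn k p (f ∘ suc))) (xor-leftComm (f zero) (f (suc p)) _)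

⊕-supported : ∀ k p (f : Fin k → Bool) → (∀ i → i ≢ p → f i ≡ false) → ⊕ k f ≡ f p
⊕-supported (suc k) p f f≗0 =
  trans (⊕-punchIn k p f)
        (trans (cong (f p xor_) (⊕-vanishes k (λ i → f≗0 (punchIn p i) (punchInᵢ≢i p i))))
               (xor-identityʳ (f p)))

⊕-supported-pair : ∀ k a b (f : Fin k → Bool) → a ≢ b →
  (∀ i → i ≢ a → i ≢ b → f i ≡ false) → f a ≡ f b → ⊕ k f ≡ false
⊕-supported-pair (suc k) a b f a≢b f≗0 fa≡fb =
  trans (⊕-punchIn k a f)
        (trans (cong (f a xor_) (trans (⊕-supported k b' (f ∘ punchIn a) off-b') fb'≡fb))
               (trans (cong (_xor f b) fa≡fb) (xor-same (f b))))
  where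
  b' = punchOut a≢b
  fb'≡fb : f (punchIn a b') ≡ f b
  fb'≡fb = cong f (punchIn-punchOut a≢b)
  off-b' : ∀ i → i ≢ b' → f (punchIn a i) ≡ false
  off-b' i i≢b' = f≗0 (punchIn a i) (punchInᵢ≢i a i)
    (λ eq → i≢b' (punchIn-injective a i b' (trans eq (sym (punchIn-punchOut a≢b)))))

⊕-swap : ∀ k m (f : Fin k → Fin m → Bool) →
  ⊕ k (λ i → ⊕ m (f i)) ≡ ⊕ m (λ j → ⊕ k (λ i → f i j))
⊕-swap zero    m f = sym (⊕-vanishes m (λ _ → refl))
⊕-swap (suc k) m f =
  trans (cong (⊕ m (f zero) xor_) (⊕-swap k m (f ∘ suc)))
        (sym (⊕-distrib-xor m (f zero) (λ j → ⊕ k (λ i → f (suc i) j))))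

δ : ∀ {k} → Fin k → Fin k → Bool
δ i j = does (i ≟ᶠ j)

δ-diag : ∀ {k} (i : Fin k) → δ i i ≡ true
δ-diag i = dec-true (i ≟ᶠ i) refl

δ-off : ∀ {k} {i j : Fin k} → i ≢ j → δ i j ≡ false
δ-off {i = i} {j} = dec-false (i ≟ᶠ j)

δ-sym : ∀ {k} (i j : Fin k) → δ i j ≡ δ j i
δ-sym i j with i ≟ᶠ j
... | yes refl = sym (δ-diag i)
... | no i≢j   = sym (δ-off (i≢j ∘ sym))

⊕-δˡ : ∀ k (i : Fin k) (f : Fin k → Bool) → ⊕ k (λ j → δ i j ∧ f j) ≡ f i
⊕-δˡ k i f =
  trans (⊕-supported k i (λ j → δ i j ∧ f j) (λ j j≢i → cong (_∧ f j) (δ-off (j≢i ∘ sym))))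
        (cong (_∧ f i) (δ-diag i))

⊕-δʳ : ∀ k (i : Fin k) (f : Fin k → Bool) → ⊕ k (λ j → f j ∧ δ j i) ≡ f i
⊕-δʳ k i f = trans (⊕-cong k (λ j → trans (∧-comm (f j) (δ j i)) (cong (_∧ f j) (δ-sym j i)))) (⊕-δˡ k i f)

-- Vectors and matrices

Matrix : ℕ → ℕ → Set
Matrix r c = Fin r → Fin c → Bool

Square : ℕ → Set
Square k = Matrix k k

column : ∀ {r c} → Matrix r c → Fin c → Fin r → Bool
column M j r = M r j

_+ᵛ_ : ∀ {k} → (Fin k → Bool) → (Fin k → Bool) → Fin k → Bool
(u +ᵛ v) i = u i xor v i

_·_ : ∀ {k} → (Fin k → Bool) → (Fin k → Bool) → Bool
_·_ {k} f x = ⊕ k (λ j → f j ∧ x j)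

·-congʳ : ∀ {k} (f : Fin k → Bool) {x y} → (∀ j → x j ≡ y j) → f · x ≡ f · y
·-congʳ {k} f x≗y = ⊕-cong k (λ j → cong (f j ∧_) (x≗y j))

·-comm : ∀ {k} (f x : Fin k → Bool) → f · x ≡ x · f
·-comm {k} f x = ⊕-cong k (λ j → ∧-comm (f j) (x j))

_*ᵛ_ : ∀ {r c} → Matrix r c → (Fin c → Bool) → Fin r → Bool
(M *ᵛ x) i = M i · x

*ᵛ-congˡ : ∀ {r c} {M N : Matrix r c} → (∀ i j → M i j ≡ N i j) → ∀ x i → (M *ᵛ x) i ≡ (N *ᵛ x) i
*ᵛ-congˡ {c = c} M≗N x i = ⊕-cong c (λ j → cong (_∧ x j) (M≗N i j))

*ᵛ-vanishes : ∀ {r c} (M : Matrix r c) {x} → Vanishes x → Vanishes (M *ᵛ x)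
*ᵛ-vanishes {c = c} M x≗0 i = trans (·-congʳ (M i) x≗0) (⊕-vanishes c (λ j → ∧-zeroʳ (M i j)))

*ᵛ-+ᵛ : ∀ {r c} (M : Matrix r c) x y i → (M *ᵛ (x +ᵛ y)) i ≡ (M *ᵛ x) i xor (M *ᵛ y) i
*ᵛ-+ᵛ {c = c} M x y i =
  trans (⊕-cong c (λ j → ∧-distribˡ-xor (M i j) (x j) (y j)))
        (⊕-distrib-xor c (λ j → M i j ∧ x j) (λ j → M i j ∧ y j))

_*ᴹ_ : ∀ {r s c} → Matrix r s → Matrix s c → Matrix r c
(M *ᴹ N) i j = M i · column N j

*ᵛ-assoc : ∀ {r s c} (M : Matrix r s) (N : Matrix s c) x i → ((M *ᴹ N) *ᵛ x) i ≡ (M *ᵛ (N *ᵛ x)) i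
*ᵛ-assoc {s = s} {c} M N x i = begin
  ⊕ c (λ j → ⊕ s (λ l → M i l ∧ N l j) ∧ x j)
    ≡⟨ ⊕-cong c (λ j → ∧-distribʳ-⊕ s (x j) (λ l → M i l ∧ N l j)) ⟩
  ⊕ c (λ j → ⊕ s (λ l → (M i l ∧ N l j) ∧ x j))
    ≡⟨ ⊕-swap c s (λ j l → (M i l ∧ N l j) ∧ x j) ⟩
  ⊕ s (λ l → ⊕ c (λ j → (M i l ∧ N l j) ∧ x j))
    ≡⟨ ⊕-cong s (λ l → ⊕-cong c (λ j → ∧-assoc (M i l) (N l j) (x j))) ⟩
  ⊕ s (λ l → ⊕ c (λ j → M i l ∧ (N l j ∧ x j)))
    ≡⟨ ⊕-cong s (λ l → sym (∧-distribˡ-⊕ c (M i l) (λ j → N l j ∧ x j))) ⟩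
  ⊕ s (λ l → M i l ∧ ⊕ c (λ j → N l j ∧ x j))
    ∎
  where open ≡-Reasoning

identity : ∀ {k} → Square k
identity = δ

*ᵛ-identity : ∀ {k} (x : Fin k → Bool) i → (identity *ᵛ x) i ≡ x i
*ᵛ-identity {k} x i = ⊕-δˡ k i x

-- Determinants

minor : ∀ {k} → Square (suc k) → Fin (suc k) → Square k
minor M j r c = M (suc r) (punchIn j c)

det-cong : ∀ k {M N : Square k} → (∀ r c → M r c ≡ N r c) → det k M ≡ det k N
det-cong zero    M≗N = refl
det-cong (suc k) M≗N =
  ⊕-cong (suc k) (λ j → cong₂ _∧_ (M≗N zero j) (det-cong k (λ r c → M≗N (suc r) (punchIn j c))))

det-linear-column : ∀ k (M N P : Square k) c →
  (∀ r j → j ≢ c → P r j ≡ M r j) → (∀ r j → j ≢ c → P r j ≡ N r j) →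
  (∀ r → P r c ≡ M r c xor N r c) → det k P ≡ det k M xor det k N
det-linear-column (suc k) M N P c P≗M P≗N Pc =
  trans (⊕-cong (suc k) term) (⊕-distrib-xor (suc k) (λ j → M zero j ∧ det k (minor M j))
                                                      (λ j → N zero j ∧ det k (minor N j)))
  where
  term : ∀ j → P zero j ∧ det k (minor P j) ≡
               (M zero j ∧ det k (minor M j)) xor (N zero j ∧ det k (minor N j))
  term j with j ≟ᶠ c
  ... | yes refl =
    let minorM = det-cong k (λ r c' → P≗M (suc r) (punchIn j c') (punchInᵢ≢i j c'))
        minorN = det-cong k (λ r c' → P≗N (suc r) (punchIn j c') (punchInᵢ≢i j c'))
    in trans (cong₂ _∧_ (Pc zero) minorM)
             (trans (∧-distribʳ-xor _ (M zero j) (N zero j))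
                    (cong (λ d → (M zero j ∧ det k (minor M j)) xor (N zero j ∧ d))
                          (trans (sym minorM) minorN)))
  ... | no j≢c =
    let c' = punchOut j≢c
        avoids : ∀ j' → j' ≢ c' → punchIn j j' ≢ c
        avoids j' j'≢c' eq = j'≢c' (punchIn-injective j j' c' (trans eq (sym (punchIn-punchOut j≢c))))
        minorP = det-linear-column k (minor M j) (minor N j) (minor P j) c'
          (λ r j' ne → P≗M (suc r) (punchIn j j') (avoids j' ne))
          (λ r j' ne → P≗N (suc r) (punchIn j j') (avoids j' ne))
          (λ r → subst (λ z → P (suc r) z ≡ M (suc r) z xor N (suc r) z)
                       (sym (punchIn-punchOut j≢c)) (Pc (suc r)))
    in trans (cong (P zero j ∧_) minorP)
             (trans (∧-distribˡ-xor (P zero j) (det k (minor M j)) (det k (minor N j)))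
                    (cong₂ _xor_ (cong (_∧ det k (minor M j)) (P≗M zero j j≢c))
                                 (cong (_∧ det k (minor N j)) (P≗N zero j j≢c))))

EqualColumns : ∀ {k} → Square k → Fin k → Fin k → Set
EqualColumns M a b = ∀ r → M r a ≡ M r b

inject₁≢suc : ∀ {k} (i : Fin k) → inject₁ i ≢ suc i
inject₁≢suc i eq = ℕ.1+n≢n (trans (sym (cong toℕ eq)) (toℕ-inject₁ i))

punchIn-avoiding-adjacent : ∀ {k} (j : Fin (suc (suc k))) (i : Fin (suc k)) →
  j ≢ inject₁ i → j ≢ suc i →
  Σ (Fin k) λ i' → (punchIn j (inject₁ i') ≡ inject₁ i) × (punchIn j (suc i') ≡ suc i)
punchIn-avoiding-adjacent zero          zero    j≢i _ = ⊥-elim (j≢i refl)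
punchIn-avoiding-adjacent {suc k} zero  (suc i) _   _ = i , refl , refl
punchIn-avoiding-adjacent (suc zero)    zero    _ j≢i+1 = ⊥-elim (j≢i+1 refl)
punchIn-avoiding-adjacent {suc k} (suc (suc j)) zero _ _ = zero , refl , refl
punchIn-avoiding-adjacent {suc k} (suc j) (suc i) j≢i j≢i+1 =
  let i' , eq , eq' = punchIn-avoiding-adjacent j i (j≢i ∘ cong suc) (j≢i+1 ∘ cong suc)
  in suc i' , cong suc eq , cong suc eq'

punchIn-adjacent : ∀ {k} (i c : Fin (suc k)) →
  (punchIn (inject₁ i) c ≡ punchIn (suc i) c) ⊎
  ((punchIn (inject₁ i) c ≡ suc i) × (punchIn (suc i) c ≡ inject₁ i))
punchIn-adjacent zero          zero    = inj₂ (refl , refl)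
punchIn-adjacent zero          (suc c) = inj₁ refl
punchIn-adjacent {suc k} (suc i) zero  = inj₁ refl
punchIn-adjacent {suc k} (suc i) (suc c) with punchIn-adjacent i c
... | inj₁ eq          = inj₁ (cong suc eq)
... | inj₂ (eq , eq')  = inj₂ (cong suc eq , cong suc eq')

-- Expanding along row 0, the terms at the two equal columns have equal minors
-- and cancel; every other minor again has two equal adjacent columns.
det-adjacent-equal-columns : ∀ k (M : Square (suc k)) (i : Fin k) →
  EqualColumns M (inject₁ i) (suc i) → det (suc k) M ≡ false
det-adjacent-equal-columns (suc k) M i Mi≗Mi+1 =
  ⊕-supported-pair (suc (suc k)) (inject₁ i) (suc i) term (inject₁≢suc i) term-off
    (cong₂ _∧_ (Mi≗Mi+1 zero) (det-cong (suc k) equal-minors))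
  where
  term : Fin (suc (suc k)) → Bool
  term j = M zero j ∧ det (suc k) (minor M j)
  term-off : ∀ j → j ≢ inject₁ i → j ≢ suc i → term j ≡ false
  term-off j j≢i j≢i+1 =
    let i' , eq , eq' = punchIn-avoiding-adjacent j i j≢i j≢i+1
        minor-vanishes = det-adjacent-equal-columns k (minor M j) i' (λ r →
          trans (cong (M (suc r)) eq) (trans (Mi≗Mi+1 (suc r)) (cong (M (suc r)) (sym eq'))))
    in trans (cong (M zero j ∧_) minor-vanishes) (∧-zeroʳ _)
  equal-minors : ∀ r c → minor M (inject₁ i) r c ≡ minor M (suc i) r c
  equal-minors r c with punchIn-adjacent i c
  ... | inj₁ eq         = cong (M (suc r)) eq
  ... | inj₂ (eq , eq') =
    trans (cong (M (suc r)) eq) (trans (sym (Mi≗Mi+1 (suc r))) (cong (M (suc r)) (sym eq')))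

setColumn : ∀ {r c} → Matrix r c → Fin c → (Fin r → Bool) → Matrix r c
setColumn M c u r j = if δ c j then u r else M r j

setColumn-hit : ∀ {r c} (M : Matrix r c) j u i → setColumn M j u i j ≡ u i
setColumn-hit M j u i rewrite δ-diag j = refl

setColumn-miss : ∀ {r c} (M : Matrix r c) {j j'} u i → j' ≢ j → setColumn M j u i j' ≡ M i j'
setColumn-miss M u i j'≢j rewrite δ-off (j'≢j ∘ sym) = refl

setColumn-self : ∀ {r c} (M : Matrix r c) j i j' → setColumn M j (column M j) i j' ≡ M i j'
setColumn-self M j i j' with j' ≟ᶠ j
... | yes refl = setColumn-hit M j (column M j) i
... | no j'≢j  = setColumn-miss M (column M j) i j'≢j

setColumn-comm : ∀ {r c} (M : Matrix r c) {a b} u v → a ≢ b → ∀ i j →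
  setColumn (setColumn M a u) b v i j ≡ setColumn (setColumn M b v) a u i j
setColumn-comm M {a} {b} u v a≢b i j with j ≟ᶠ a | j ≟ᶠ b
... | yes refl | yes refl = ⊥-elim (a≢b refl)
... | yes refl | no j≢b =
  trans (setColumn-miss (setColumn M a u) v i j≢b)
        (trans (setColumn-hit M a u i) (sym (setColumn-hit (setColumn M b v) a u i)))
... | no j≢a | yes refl =
  trans (setColumn-hit (setColumn M a u) b v i)
        (trans (sym (setColumn-hit M b v i)) (sym (setColumn-miss (setColumn M b v) u i j≢a)))
... | no j≢a | no j≢b =
  trans (setColumn-miss (setColumn M a u) v i j≢b)
        (trans (setColumn-miss M u i j≢a)
               (sym (trans (setColumn-miss (setColumn M b v) u i j≢a) (setColumn-miss M v i j≢b))))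

det-setColumn-+ᵛ : ∀ k (M : Square k) c u v →
  det k (setColumn M c (u +ᵛ v)) ≡ det k (setColumn M c u) xor det k (setColumn M c v)
det-setColumn-+ᵛ k M c u v =
  det-linear-column k (setColumn M c u) (setColumn M c v) (setColumn M c (u +ᵛ v)) c
    (λ r j j≢c → trans (setColumn-miss M (u +ᵛ v) r j≢c) (sym (setColumn-miss M u r j≢c)))
    (λ r j j≢c → trans (setColumn-miss M (u +ᵛ v) r j≢c) (sym (setColumn-miss M v r j≢c)))
    (λ r → trans (setColumn-hit M c (u +ᵛ v) r)
                 (sym (cong₂ _xor_ (setColumn-hit M c u r) (setColumn-hit M c v r))))

swapColumns : ∀ {k} → Square k → Fin k → Fin k → Square k
swapColumns M a b = setColumn (setColumn M a (column M b)) b (column M a)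

-- The determinant, restricted to columns a and b, is an alternating bilinear
-- form; over F₂ alternating forms are symmetric.
det-swapColumns : ∀ k (M : Square k) a b → a ≢ b →
  (∀ N → EqualColumns N a b → det k N ≡ false) →
  det k (swapColumns M a b) ≡ det k M
det-swapColumns k M a b a≢b alternating =
  trans (sym (xor≡false⇒≡ _ _ antisymmetric))
        (det-cong k restored)
  where
  open ≡-Reasoning
  D : (Fin k → Bool) → (Fin k → Bool) → Bool
  D u v = det k (setColumn (setColumn M a u) b v)
  ca = column M a
  cb = column M b
  restored : ∀ r j → setColumn (setColumn M a ca) b cb r j ≡ M r j
  restored r j with j ≟ᶠ b
  ... | yes refl = setColumn-hit (setColumn M a ca) b cb r
  ... | no j≢b   = trans (setColumn-miss (setColumn M a ca) cb r j≢b) (setColumn-self M a r j)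
  linearʳ : ∀ u v v' → D u (v +ᵛ v') ≡ D u v xor D u v'
  linearʳ u = det-setColumn-+ᵛ k (setColumn M a u) b
  commuted : ∀ u v → D u v ≡ det k (setColumn (setColumn M b v) a u)
  commuted u v = det-cong k (setColumn-comm M u v a≢b)
  linearˡ : ∀ u u' v → D (u +ᵛ u') v ≡ D u v xor D u' v
  linearˡ u u' v = trans (commuted (u +ᵛ u') v)
    (trans (det-setColumn-+ᵛ k (setColumn M b v) a u u')
           (sym (cong₂ _xor_ (commuted u v) (commuted u' v))))
  diagonal : ∀ u → D u u ≡ false
  diagonal u = alternating (setColumn (setColumn M a u) b u) (λ r →
    trans (setColumn-miss (setColumn M a u) u r a≢b)
          (trans (setColumn-hit M a u r) (sym (setColumn-hit (setColumn M a u) b u r))))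
  antisymmetric : D ca cb xor D cb ca ≡ false
  antisymmetric = begin
    D ca cb xor D cb ca                              ≡⟨ cong (D ca cb xor_) (sym (xor-identityʳ _)) ⟩
    (false xor D ca cb) xor (D cb ca xor false)      ≡⟨ cong₂ (λ x y → (x xor D ca cb) xor (D cb ca xor y))
                                                              (sym (diagonal ca)) (sym (diagonal cb)) ⟩
    (D ca ca xor D ca cb) xor (D cb ca xor D cb cb)  ≡⟨ cong₂ _xor_ (sym (linearʳ ca ca cb))
                                                                    (sym (linearʳ cb ca cb)) ⟩
    D ca (ca +ᵛ cb) xor D cb (ca +ᵛ cb)              ≡⟨ sym (linearˡ ca cb (ca +ᵛ cb)) ⟩
    D (ca +ᵛ cb) (ca +ᵛ cb)                          ≡⟨ diagonal (ca +ᵛ cb) ⟩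
    false                                            ∎

-- Swapping columns b - 1 and b moves the repeated column one step closer to a.
det-equal-columns-at-distance : ∀ d k (M : Square k) a b → d + suc (toℕ a) ≡ toℕ b →
  EqualColumns M a b → det k M ≡ false
det-equal-columns-at-distance zero (suc k) M a (suc i) 1+a≡b Ma≗Mb =
  det-adjacent-equal-columns k M i (λ r → trans (cong (M r) (sym a≡i)) (Ma≗Mb r))
  where
  a≡i : a ≡ inject₁ i
  a≡i = toℕ-injective (trans (ℕ.suc-injective 1+a≡b) (sym (toℕ-inject₁ i)))
det-equal-columns-at-distance (suc d) (suc k) M a (suc i) d+1+a≡b Ma≗Mb =
  trans (sym (det-swapColumns (suc k) M i' b (inject₁≢suc i) (λ N → det-adjacent-equal-columns k N i)))
        (det-equal-columns-at-distance d (suc k) (swapColumns M i' b) a i' d+1+a≡i' swapped-equal)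
  where
  i' = inject₁ i
  b = suc i
  d+1+a≡i' : d + suc (toℕ a) ≡ toℕ i'
  d+1+a≡i' = trans (ℕ.suc-injective d+1+a≡b) (sym (toℕ-inject₁ i))
  a≢i' : a ≢ i'
  a≢i' = ℕ.<⇒≢ (subst (suc (toℕ a) ≤_) d+1+a≡i' (ℕ.m≤n+m _ d)) ∘ cong toℕ
  a≢b : a ≢ b
  a≢b = ℕ.<⇒≢ (subst (suc (toℕ a) ≤_) d+1+a≡b (ℕ.m≤n+m _ (suc d))) ∘ cong toℕ
  swapped-equal : EqualColumns (swapColumns M i' b) a i'
  swapped-equal r =
    trans (setColumn-miss (setColumn M i' (column M b)) (column M i') r a≢b)
     (trans (setColumn-miss M (column M b) r a≢i')
      (trans (Ma≗Mb r)
       (sym (trans (setColumn-miss (setColumn M i' (column M b)) (column M i') r (inject₁≢suc i))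
                   (setColumn-hit M i' (column M b) r)))))

det-equal-columns : ∀ k (M : Square k) {a b} → a ≢ b → EqualColumns M a b → det k M ≡ false
det-equal-columns k M {a} {b} a≢b Ma≗Mb with ℕ.<-cmp (toℕ a) (toℕ b)
... | tri< a<b _ _ = det-equal-columns-at-distance _ k M a b (ℕ.m∸n+n≡m a<b) Ma≗Mb
... | tri≈ _ a≡b _ = ⊥-elim (a≢b (toℕ-injective a≡b))
... | tri> _ _ b<a = det-equal-columns-at-distance _ k M b a (ℕ.m∸n+n≡m b<a) (sym ∘ Ma≗Mb)

det-add-column : ∀ k (M : Square k) {c p} → c ≢ p →
  det k (setColumn M c (column M c +ᵛ column M p)) ≡ det k M
det-add-column k M {c} {p} c≢p =
  trans (det-setColumn-+ᵛ k M c (column M c) (column M p))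
        (trans (cong₂ _xor_ (det-cong k (setColumn-self M c)) repeated-column) (xor-identityʳ _))
  where
  repeated-column : det k (setColumn M c (column M p)) ≡ false
  repeated-column = det-equal-columns k (setColumn M c (column M p)) c≢p (λ r →
    trans (setColumn-hit M c (column M p) r) (sym (setColumn-miss M (column M p) r (c≢p ∘ sym))))

weight : ∀ k → (Fin k → Bool) → ℕ
weight zero    f = 0
weight (suc k) f = (if f zero then 1 else 0) + weight k (f ∘ suc)

weight-cong : ∀ k {f g : Fin k → Bool} → (∀ i → f i ≡ g i) → weight k f ≡ weight k g
weight-cong zero    f≗g = refl
weight-cong (suc k) f≗g = cong₂ _+_ (cong (if_then 1 else 0) (f≗g zero)) (weight-cong k (f≗g ∘ suc))

weight-clear : ∀ k (f g : Fin k → Bool) c → f c ≡ true → g c ≡ false →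
  (∀ j → j ≢ c → g j ≡ f j) → weight k g < weight k f
weight-clear (suc k) f g zero fc gc g≗f rewrite fc | gc =
  s≤s (ℕ.≤-reflexive (weight-cong k (λ i → g≗f (suc i) λ ())))
weight-clear (suc k) f g (suc c) fc gc g≗f rewrite g≗f zero (λ ()) =
  ℕ.+-monoʳ-< (if f zero then 1 else 0)
    (weight-clear k (f ∘ suc) (g ∘ suc) c fc gc (λ j j≢c → g≗f (suc j) (j≢c ∘ suc-injective)))

eliminate : ∀ {m} → (f g : Fin (suc m) → Bool) → Fin (suc m) → Fin m → Bool
eliminate f g p c = g (punchIn p c) xor (f (punchIn p c) ∧ g p)

schurComplement : ∀ {k m} → Matrix (suc k) (suc m) → Fin (suc m) → Matrix k m
schurComplement M p r = eliminate (M zero) (M (suc r)) p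

det-row-supported-at-pivot : ∀ k (M : Square (suc k)) p → M zero p ≡ true →
  (∀ c → c ≢ p → M zero c ≡ false) → det (suc k) M ≡ det k (schurComplement M p)
det-row-supported-at-pivot k M p Mp row≗δp =
  trans (⊕-supported (suc k) p (λ j → M zero j ∧ det k (minor M j))
          (λ j j≢p → cong (_∧ det k (minor M j)) (row≗δp j j≢p)))
        (trans (cong (_∧ det k (minor M p)) Mp)
               (det-cong k (λ r c → sym (trans
                  (cong (λ x → M (suc r) (punchIn p c) xor (x ∧ M (suc r) p))
                        (row≗δp (punchIn p c) (punchInᵢ≢i p c)))
                  (xor-identityʳ _)))))

-- Clearing row 0 one column at a time; each column operation preserves the
-- determinant and the Schur complement, and lowers the weight of row 0.
det-schurComplement-within : ∀ n k (M : Square (suc k)) p → weight (suc k) (M zero) ≤ n →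
  M zero p ≡ true → det (suc k) M ≡ det k (schurComplement M p)
det-schurComplement-within n k M p bound Mp
  with any? (λ c → ¬? (c ≟ᶠ p) ×-dec (M zero c Bool.≟ true))
... | no none = det-row-supported-at-pivot k M p Mp (λ c c≢p → ¬-not (λ Mc → none (c , c≢p , Mc)))
... | yes (c , c≢p , Mc) = clear n bound
  where
  N : Square (suc k)
  N = setColumn M c (column M c +ᵛ column M p)
  N-pivot : N zero p ≡ true
  N-pivot = trans (setColumn-miss M (column M c +ᵛ column M p) zero (c≢p ∘ sym)) Mp
  N-cleared : N zero c ≡ false
  N-cleared = trans (setColumn-hit M c (column M c +ᵛ column M p) zero) (cong₂ _xor_ Mc Mp)
  lighter : weight (suc k) (N zero) < weight (suc k) (M zero)
  lighter = weight-clear (suc k) (M zero) (N zero) c Mc N-cleared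
              (λ j j≢c → setColumn-miss M (column M c +ᵛ column M p) zero j≢c)
  same-complement : ∀ r c' → schurComplement N p r c' ≡ schurComplement M p r c'
  same-complement r c' with punchIn p c' ≟ᶠ c
  ... | yes refl = begin
    N (suc r) j xor (N zero j ∧ N (suc r) p)  ≡⟨ cong₂ (λ x y → x xor (y ∧ N (suc r) p))
                                                        (setColumn-hit M j (column M j +ᵛ column M p) (suc r)) N-cleared ⟩
    (M (suc r) j xor M (suc r) p) xor false   ≡⟨ xor-identityʳ _ ⟩
    M (suc r) j xor M (suc r) p               ≡⟨ cong (λ x → M (suc r) j xor (x ∧ M (suc r) p)) (sym Mc) ⟩
    M (suc r) j xor (M zero j ∧ M (suc r) p)  ∎
    where
    open ≡-Reasoning
    j = punchIn p c'
  ... | no j≢c =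
    trans (cong₂ (λ x y → x xor (y ∧ N (suc r) p))
                 (setColumn-miss M (column M c +ᵛ column M p) (suc r) j≢c)
                 (setColumn-miss M (column M c +ᵛ column M p) zero j≢c))
          (cong (λ x → M (suc r) (punchIn p c') xor (M zero (punchIn p c') ∧ x))
                (setColumn-miss M (column M c +ᵛ column M p) (suc r) (c≢p ∘ sym)))
  clear : ∀ n → weight (suc k) (M zero) ≤ n → det (suc k) M ≡ det k (schurComplement M p)
  clear zero    bound = ⊥-elim (ℕ.n≮0 (ℕ.<-≤-trans lighter bound))
  clear (suc n) bound =
    trans (sym (det-add-column (suc k) M c≢p))
          (trans (det-schurComplement-within n k N p (ℕ.≤-pred (ℕ.<-≤-trans lighter bound)) N-pivot)
                 (det-cong k same-complement))

det-schurComplement : ∀ k (M : Square (suc k)) p → M zero p ≡ true →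
  det (suc k) M ≡ det k (schurComplement M p)
det-schurComplement k M p = det-schurComplement-within _ k M p ℕ.≤-refl

-- Kernels

TrivialKernel : ∀ {r c} → Matrix r c → Set
TrivialKernel M = ∀ x → Vanishes (M *ᵛ x) → Vanishes x

NontrivialKernel : ∀ {r c} → Matrix r c → Set
NontrivialKernel {c = c} M = Σ (Fin c → Bool) λ x → Nonzero x × Vanishes (M *ᵛ x)

-- The value x p is forced to take when x is orthogonal to a row f with f p = 1.
pivotValue : ∀ {m} → (Fin (suc m) → Bool) → Fin (suc m) → (Fin m → Bool) → Bool
pivotValue f p y = (f ∘ punchIn p) · y

pivotLift : ∀ {m} → (Fin (suc m) → Bool) → Fin (suc m) → (Fin m → Bool) → Fin (suc m) → Bool
pivotLift f p y = insertAt y p (pivotValue f p y)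

·-pivot : ∀ {m} (f x : Fin (suc m) → Bool) p → f p ≡ true →
  f · x ≡ x p xor pivotValue f p (x ∘ punchIn p)
·-pivot {m} f x p fp =
  trans (⊕-punchIn m p (λ j → f j ∧ x j)) (cong (λ b → (b ∧ x p) xor pivotValue f p (x ∘ punchIn p)) fp)

·-eliminate : ∀ {m} (f g x : Fin (suc m) → Bool) p → x p ≡ pivotValue f p (x ∘ punchIn p) →
  g · x ≡ eliminate f g p · (x ∘ punchIn p)
·-eliminate {m} f g x p xp = begin
  g · x
    ≡⟨ ⊕-punchIn m p (λ j → g j ∧ x j) ⟩
  (g p ∧ x p) xor g′ · y
    ≡⟨ cong (λ b → (g p ∧ b) xor g′ · y) xp ⟩
  (g p ∧ f′ · y) xor g′ · y
    ≡⟨ cong (_xor g′ · y) (∧-distribˡ-⊕ m (g p) (λ c → f′ c ∧ y c)) ⟩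
  ⊕ m (λ c → g p ∧ (f′ c ∧ y c)) xor g′ · y
    ≡⟨ xor-comm (⊕ m (λ c → g p ∧ (f′ c ∧ y c))) (g′ · y) ⟩
  g′ · y xor ⊕ m (λ c → g p ∧ (f′ c ∧ y c))
    ≡⟨ cong (g′ · y xor_) (⊕-cong m (λ c → ∧-rotate (g p) (f′ c) (y c))) ⟩
  g′ · y xor ⊕ m (λ c → (f′ c ∧ g p) ∧ y c)
    ≡⟨ sym (⊕-distrib-xor m (λ c → g′ c ∧ y c) (λ c → (f′ c ∧ g p) ∧ y c)) ⟩
  ⊕ m (λ c → (g′ c ∧ y c) xor ((f′ c ∧ g p) ∧ y c))
    ≡⟨ ⊕-cong m (λ c → sym (∧-distribʳ-xor (y c) (g′ c) (f′ c ∧ g p))) ⟩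
  eliminate f g p · y
    ∎
  where
  open ≡-Reasoning
  y = x ∘ punchIn p
  f′ = f ∘ punchIn p
  g′ = g ∘ punchIn p

pivotLift-punchIn : ∀ {m} (f : Fin (suc m) → Bool) p y c → pivotLift f p y (punchIn p c) ≡ y c
pivotLift-punchIn f p y = insertAt-punchIn y p (pivotValue f p y)

pivotLift-pivot : ∀ {m} (f : Fin (suc m) → Bool) p y →
  pivotLift f p y p ≡ pivotValue f p (pivotLift f p y ∘ punchIn p)
pivotLift-pivot f p y =
  trans (insertAt-lookup y p _) (sym (·-congʳ (f ∘ punchIn p) (pivotLift-punchIn f p y)))

·-pivotLift : ∀ {m} (f g : Fin (suc m) → Bool) p y → g · pivotLift f p y ≡ eliminate f g p · y
·-pivotLift f g p y = trans (·-eliminate f g (pivotLift f p y) p (pivotLift-pivot f p y))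
                           (·-congʳ (eliminate f g p) (pivotLift-punchIn f p y))

·-pivotLift-pivotRow : ∀ {m} (f : Fin (suc m) → Bool) p y → f p ≡ true → f · pivotLift f p y ≡ false
·-pivotLift-pivotRow f p y fp =
  trans (·-pivot f (pivotLift f p y) p fp)
        (trans (cong (_xor pivotValue f p (pivotLift f p y ∘ punchIn p)) (pivotLift-pivot f p y))
               (xor-same (pivotValue f p (pivotLift f p y ∘ punchIn p))))

kernel-pivotLift : ∀ {k m} (M : Matrix (suc k) (suc m)) p → M zero p ≡ true → ∀ y →
  Vanishes (schurComplement M p *ᵛ y) → Vanishes (M *ᵛ pivotLift (M zero) p y)
kernel-pivotLift M p Mp y Sy≗0 zero    = ·-pivotLift-pivotRow (M zero) p y Mp
kernel-pivotLift M p Mp y Sy≗0 (suc r) = trans (·-pivotLift (M zero) (M (suc r)) p y) (Sy≗0 r)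

kernel-restrict : ∀ {k m} (M : Matrix (suc k) (suc m)) p → M zero p ≡ true → ∀ x →
  Vanishes (M *ᵛ x) →
  (x p ≡ pivotValue (M zero) p (x ∘ punchIn p)) × Vanishes (schurComplement M p *ᵛ (x ∘ punchIn p))
kernel-restrict M p Mp x Mx≗0 =
  x-pivot , λ r → trans (sym (·-eliminate (M zero) (M (suc r)) x p x-pivot)) (Mx≗0 (suc r))
  where
  x-pivot = xor≡false⇒≡ _ _ (trans (sym (·-pivot (M zero) x p Mp)) (Mx≗0 zero))

wide-nontrivialKernel : ∀ k (M : Matrix k (suc k)) → NontrivialKernel M
wide-nontrivialKernel zero    M = (λ _ → true) , (zero , refl) , (λ ())
wide-nontrivialKernel (suc k) M with someTrue? (M zero)
... | inj₁ (p , Mp) =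
  let y , (c , yc) , Sy≗0 = wide-nontrivialKernel k (schurComplement M p)
  in pivotLift (M zero) p y , (punchIn p c , trans (pivotLift-punchIn (M zero) p y c) yc) ,
     kernel-pivotLift M p Mp y Sy≗0
... | inj₂ row₀≗0 =
  let y , (c , yc) , M'y≗0 = wide-nontrivialKernel k (λ r c → M (suc r) (suc c))
  in insertAt y zero false , (suc c , yc) , λ
     { zero    → ⊕-vanishes (suc (suc k)) (λ j → cong (_∧ insertAt y zero false j) (row₀≗0 j))
     ; (suc r) → trans (cong (_xor (M (suc r) ∘ suc) · y) (∧-zeroʳ (M (suc r) zero))) (M'y≗0 r) }

det≡true⇔trivialKernel : ∀ k (M : Square k) → (det k M ≡ true) ⇔ TrivialKernel M
det≡true⇔trivialKernel zero    M = mk⇔ (λ _ _ _ ()) (λ _ → refl)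
det≡true⇔trivialKernel (suc k) M with someTrue? (M zero)
... | inj₁ (p , Mp) = mk⇔
  (λ det≡1 → fromSchur (Equivalence.to   (det≡true⇔trivialKernel k S) (trans (sym schur) det≡1)))
  (λ trivial → trans schur (Equivalence.from (det≡true⇔trivialKernel k S) (toSchur trivial)))
  where
  S = schurComplement M p
  schur = det-schurComplement k M p Mp
  toSchur : TrivialKernel M → TrivialKernel S
  toSchur trivial y Sy≗0 c =
    trans (sym (pivotLift-punchIn (M zero) p y c))
          (trivial (pivotLift (M zero) p y) (kernel-pivotLift M p Mp y Sy≗0) (punchIn p c))
  fromSchur : TrivialKernel S → TrivialKernel M
  fromSchur trivial x Mx≗0 =
    let x-pivot , Sx≗0 = kernel-restrict M p Mp x Mx≗0
        x∘punchIn≗0 = trivial (x ∘ punchIn p) Sx≗0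
    in ≗-via-punchIn p
         (trans x-pivot (trans (·-congʳ (M zero ∘ punchIn p) x∘punchIn≗0)
                               (⊕-vanishes k (λ c → ∧-zeroʳ _))))
         x∘punchIn≗0
... | inj₂ row₀≗0 = mk⇔
  (λ det≡1 → ⊥-elim (Bool.not-¬ det≡0 det≡1))
  (λ trivial → ⊥-elim (Bool.not-¬ (trivial x Mx≗0 c) xc))
  where
  det≡0 : det (suc k) M ≡ false
  det≡0 = ⊕-vanishes (suc k) (λ j → cong (_∧ det k (minor M j)) (row₀≗0 j))
  kernel = wide-nontrivialKernel k (M ∘ suc)
  x = proj₁ kernel
  c = proj₁ (proj₁ (proj₂ kernel))
  xc = proj₂ (proj₁ (proj₂ kernel))
  Mx≗0 : Vanishes (M *ᵛ x)
  Mx≗0 zero    = ⊕-vanishes (suc k) (λ j → cong (_∧ x j) (row₀≗0 j))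
  Mx≗0 (suc r) = proj₂ (proj₂ kernel) r

-- A nonzero kernel vector x of the k × (k+1) matrix (z | Q) has x 0 = 1
-- because Q is injective, and then Q (x ∘ suc) = z.
trivialKernel⇒onto : ∀ k (Q : Square k) → TrivialKernel Q →
  ∀ (z : Fin k → Bool) → Σ (Fin k → Bool) λ a → ∀ e → (Q *ᵛ a) e ≡ z e
trivialKernel⇒onto k Q trivial z =
  x ∘ suc , λ e → trans (Qx≡zx₀ e) (trans (cong (z e ∧_) x₀≡true) (∧-identityʳ (z e)))
  where
  kernel = wide-nontrivialKernel k (λ e → z e ∷ Q e)
  x = proj₁ kernel
  Qx≡zx₀ : ∀ e → (Q *ᵛ (x ∘ suc)) e ≡ z e ∧ x zero
  Qx≡zx₀ e = sym (xor≡false⇒≡ (z e ∧ x zero) _ (proj₂ (proj₂ kernel) e))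
  x₀≡true : x zero ≡ true
  x₀≡true = ¬-not λ x₀≡false →
    let x≗0 : Vanishes x
        x≗0 = ≗-via-punchIn zero x₀≡false
                (trivial (x ∘ suc) (λ e → trans (Qx≡zx₀ e) (trans (cong (z e ∧_) x₀≡false) (∧-zeroʳ (z e)))))
        c , xc = proj₁ (proj₂ kernel)
    in Bool.not-¬ (x≗0 c) xc

-- Principal submatrices

TrivialKernelOn : ∀ {n} → Square n → (Fin n → Bool) → Set
TrivialKernelOn A φ =
  ∀ z → (∀ e → φ e ≡ false → z e ≡ false) → (∀ e → φ e ≡ true → (A *ᵛ z) e ≡ false) → Vanishes z

record Enumeration {n} (φ : Fin n → Bool) (m : ℕ) : Set where
  field
    index     : Fin m → Fin n
    sound     : ∀ j → φ (index j) ≡ true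
    complete  : ∀ e → φ e ≡ true → Σ (Fin m) λ j → index j ≡ e
    injective : ∀ {i j} → index i ≡ index j → i ≡ j

module _ {n m} {φ : Fin n → Bool} (enumeration : Enumeration φ m) where
  open Enumeration enumeration

  ⊕-reindex : ∀ f → (∀ d → φ d ≡ false → f d ≡ false) → ⊕ m (f ∘ index) ≡ ⊕ n f
  ⊕-reindex f f-supported = begin
    ⊕ m (f ∘ index)                                ≡⟨ ⊕-cong m (λ j → sym (⊕-δˡ n (index j) f)) ⟩
    ⊕ m (λ j → ⊕ n (λ d → δ (index j) d ∧ f d))    ≡⟨ ⊕-swap m n (λ j d → δ (index j) d ∧ f d) ⟩
    ⊕ n (λ d → ⊕ m (λ j → δ (index j) d ∧ f d))    ≡⟨ ⊕-cong n collapse ⟩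
    ⊕ n f                                          ∎
    where
    open ≡-Reasoning
    collapse : ∀ d → ⊕ m (λ j → δ (index j) d ∧ f d) ≡ f d
    collapse d with φ d in φd
    ... | false = trans (⊕-vanishes m (λ j → trans (cong (δ (index j) d ∧_) (f-supported d φd)) (∧-zeroʳ _)))
                        (sym (f-supported d φd))
    ... | true with complete d φd
    ...   | j₀ , refl =
      trans (⊕-supported m j₀ (λ j → δ (index j) (index j₀) ∧ f (index j₀))
               (λ j j≢j₀ → cong (_∧ f (index j₀)) (δ-off (j≢j₀ ∘ injective))))
            (cong (_∧ f (index j₀)) (δ-diag (index j₀)))

  trivialKernelOn⇔trivialKernel : ∀ A → TrivialKernelOn A φ ⇔ TrivialKernel (λ i j → A (index i) (index j))
  trivialKernelOn⇔trivialKernel A = mk⇔ to from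
    where
    restrictRow : ∀ z → (∀ e → φ e ≡ false → z e ≡ false) → ∀ i →
      ((λ i j → A (index i) (index j)) *ᵛ (z ∘ index)) i ≡ (A *ᵛ z) (index i)
    restrictRow z z-supported i =
      ⊕-reindex (λ d → A (index i) d ∧ z d)
                (λ d φd → trans (cong (A (index i) d ∧_) (z-supported d φd)) (∧-zeroʳ _))
    to : TrivialKernelOn A φ → TrivialKernel (λ i j → A (index i) (index j))
    to trivial y Ay≗0 c = trans (sym (z-index c)) (z≗0 (index c))
      where
      z : Fin n → Bool
      z e = ⊕ m (λ j → δ (index j) e ∧ y j)
      z-index : ∀ c → z (index c) ≡ y c
      z-index c =
        trans (⊕-supported m c (λ j → δ (index j) (index c) ∧ y j)
                 (λ j j≢c → cong (_∧ y j) (δ-off (j≢c ∘ injective))))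
              (cong (_∧ y c) (δ-diag (index c)))
      z-supported : ∀ e → φ e ≡ false → z e ≡ false
      z-supported e φe = ⊕-vanishes m (λ j → cong (_∧ y j)
        (δ-off (λ index≡e → Bool.not-¬ φe (trans (cong φ (sym index≡e)) (sound j)))))
      z≗0 : Vanishes z
      z≗0 = trivial z z-supported λ e φe → case complete e φe of λ where
        (i , refl) → trans (sym (restrictRow z z-supported i))
                           (trans (·-congʳ (λ j → A (index i) (index j)) z-index) (Ay≗0 i))
    from : TrivialKernel (λ i j → A (index i) (index j)) → TrivialKernelOn A φ
    from trivial z z-supported Az≗0 e with φ e in φe
    ... | false = z-supported e φe
    ... | true with complete e φe
    ...   | j , refl = trivial (z ∘ index) (λ i → trans (restrictRow z z-supported i) (Az≗0 (index i) (sound i))) j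

lookup-injective : ∀ {A : Set} {xs : List A} → Unique xs → ∀ {i j} → List.lookup xs i ≡ List.lookup xs j → i ≡ j
lookup-injective (_    AllPairs.∷ _)      {zero}  {zero}  _  = refl
lookup-injective (x∉xs AllPairs.∷ _)      {zero}  {suc j} eq = ⊥-elim (All.lookup x∉xs (∈-lookup j) eq)
lookup-injective (x∉xs AllPairs.∷ _)      {suc i} {zero}  eq = ⊥-elim (All.lookup x∉xs (∈-lookup i) (sym eq))
lookup-injective (_    AllPairs.∷ unique) {suc i} {suc j} eq = cong suc (lookup-injective unique eq)

elems-enumeration : ∀ {n} (U : Subset n) → Enumeration (lookup U) (length (elems U))
elems-enumeration {n} U = record
  { index     = List.lookup (elems U)
  ; sound     = λ j → Equivalence.to Bool.T-≡ (proj₂ (∈-filter⁻ (T? ∘ lookup U) {xs = allFin n} (∈-lookup j)))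
  ; complete  = λ e Ue → let e∈U = ∈-filter⁺ (T? ∘ lookup U) (∈-allFin e) (Equivalence.from Bool.T-≡ Ue)
                         in Any.index e∈U , sym (lookup-index e∈U)
  ; injective = lookup-injective (Unique.filter⁺ (T? ∘ lookup U) (Unique.allFin⁺ n))
  }

-- Isotropic families and transversal coordinate Lagrangians

Family : ℕ → ℕ → Set
Family k m = Fin k → V m

Independent : ∀ {k m} → Family k m → Set
Independent b = ∀ a → IsZero (comb b a) → Vanishes a

Isotropic : ∀ {k m} → Family k m → Set
Isotropic b = ∀ a c → form (comb b a) (comb b c) ≡ false

-- v lies in ⟨Y^∨ ⊔ (E∖Y)⟩ iff projY Y v vanishes.
projY : ∀ {m} → (Fin m → Bool) → V m → Fin m → Bool
projY Y (x , x') e = if Y e then x e else x' e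

Transversal : ∀ {k m} → (Fin m → Bool) → Family k m → Set
Transversal Y b = ∀ a → Vanishes (projY Y (comb b a)) → Vanishes a

TransversalExists : ℕ → Set
TransversalExists m =
  ∀ {k} (b : Family k m) → Independent b → Isotropic b → Σ (Fin m → Bool) λ Y → Transversal Y b

_≈ᵛ_ : ∀ {m} → V m → V m → Set
(x , x') ≈ᵛ (y , y') = (∀ e → x e ≡ y e) × (∀ e → x' e ≡ y' e)

form-cong : ∀ {m} {v v' w w' : V m} → v ≈ᵛ v' → w ≈ᵛ w' → form v w ≡ form v' w'
form-cong {m} (v₁ , v₂) (w₁ , w₂) =
  ⊕-cong m (λ e → cong₂ _xor_ (cong₂ _∧_ (v₁ e) (w₂ e)) (cong₂ _∧_ (v₂ e) (w₁ e)))

form-zeroˡ : ∀ {m} (v w : V m) → IsZero v → form v w ≡ false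
form-zeroˡ {m} v w v≈0 =
  ⊕-vanishes m (λ e → cong₂ (λ x x' → (x ∧ proj₂ w e) xor (x' ∧ proj₁ w e))
                            (proj₁ (v≈0 e)) (proj₂ (v≈0 e)))

comb-cong : ∀ {k m} (b : Family k m) {a a'} → (∀ i → a i ≡ a' i) → comb b a ≈ᵛ comb b a'
comb-cong {k} b a≗a' =
  (λ e → ⊕-cong k (λ i → cong (_∧ _) (a≗a' i))) , (λ e → ⊕-cong k (λ i → cong (_∧ _) (a≗a' i)))

comb-vanishes : ∀ {k m} (b : Family k m) {a} → Vanishes a → IsZero (comb b a)
comb-vanishes {k} b a≗0 e =
  ⊕-vanishes k (λ i → cong (_∧ proj₁ (b i) e) (a≗0 i)) ,
  ⊕-vanishes k (λ i → cong (_∧ proj₂ (b i) e) (a≗0 i))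

projY-cong : ∀ {m} (Y : Fin m → Bool) {v w : V m} → v ≈ᵛ w → ∀ e → projY Y v e ≡ projY Y w e
projY-cong Y (v₁ , v₂) e = cong₂ (if Y e then_else_) (v₁ e) (v₂ e)

tailᵛ : ∀ {m} → V (suc m) → V m
tailᵛ (x , x') = x ∘ suc , x' ∘ suc

form₀ : ∀ {m} → V (suc m) → V (suc m) → Bool
form₀ (x , x') (y , y') = (x zero ∧ y' zero) xor (x' zero ∧ y zero)

transversal-coordinate₀-unused : ∀ {m k} → TransversalExists m → (b : Family k (suc m)) →
  (∀ i → proj₁ (b i) zero ≡ false) → (∀ i → proj₂ (b i) zero ≡ false) →
  Independent b → Isotropic b → Σ (Fin (suc m) → Bool) λ Y → Transversal Y b
transversal-coordinate₀-unused {k = k} ih b primal₀≗0 dual₀≗0 ind iso =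
  let Y , transversal = ih (tailᵛ ∘ b) ind′ iso′
  in false ∷ Y , λ a Ya≗0 → transversal a (Ya≗0 ∘ suc)
  where
  primal₀ : ∀ a → proj₁ (comb b a) zero ≡ false
  primal₀ a = ⊕-vanishes k (λ i → trans (cong (a i ∧_) (primal₀≗0 i)) (∧-zeroʳ (a i)))
  dual₀ : ∀ a → proj₂ (comb b a) zero ≡ false
  dual₀ a = ⊕-vanishes k (λ i → trans (cong (a i ∧_) (dual₀≗0 i)) (∧-zeroʳ (a i)))
  ind′ : Independent (tailᵛ ∘ b)
  ind′ a tail≈0 = ind a λ { zero → primal₀ a , dual₀ a ; (suc e) → tail≈0 e }
  iso′ : Isotropic (tailᵛ ∘ b)
  iso′ a c = trans (cong (_xor form (tailᵛ (comb b a)) (tailᵛ (comb b c)))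
                         (sym (cong₂ (λ x x' → (x ∧ proj₂ (comb b c) zero) xor (x' ∧ proj₁ (comb b c) zero))
                                     (primal₀ a) (dual₀ a))))
                   (iso a c)

-- Gaussian elimination on the dual coordinate 0: every combination of the
-- family with vanishing dual 0-coordinate is a combination of the reduced
-- family, which lives on the remaining coordinates.
module DualPivotReduction {m k} (b : Family (suc k) (suc m)) (i₀ : Fin (suc k))
                          (pivot : proj₂ (b i₀) zero ≡ true) where

  G : Fin (suc k) → Bool
  G i = proj₂ (b i) zero

  lift : (Fin k → Bool) → Fin (suc k) → Bool
  lift = pivotLift G i₀

  reduced : Family k m
  reduced j = (λ e → eliminate G (λ i → proj₁ (b i) (suc e)) i₀ j) ,
              (λ e → eliminate G (λ i → proj₂ (b i) (suc e)) i₀ j)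

  comb-lift : ∀ a′ → comb reduced a′ ≈ᵛ tailᵛ (comb b (lift a′))
  comb-lift a′ = (λ e → lift-row (λ i → proj₁ (b i) (suc e))) , (λ e → lift-row (λ i → proj₂ (b i) (suc e)))
    where
    lift-row : ∀ (F : Fin (suc k) → Bool) → a′ · eliminate G F i₀ ≡ lift a′ · F
    lift-row F = trans (·-comm a′ (eliminate G F i₀)) (trans (sym (·-pivotLift G F i₀ a′)) (·-comm F (lift a′)))

  dual₀-lift : ∀ a′ → proj₂ (comb b (lift a′)) zero ≡ false
  dual₀-lift a′ = trans (·-comm (lift a′) G) (·-pivotLift-pivotRow G i₀ a′ pivot)

  reduced-isotropic : Isotropic b → Isotropic reduced
  reduced-isotropic iso a′ c′ = trans (form-cong (comb-lift a′) (comb-lift c′)) (trans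
    (cong (_xor form (tailᵛ v) (tailᵛ w))
          (sym (trans (cong₂ (λ x x' → (proj₁ v zero ∧ x) xor (x' ∧ proj₁ w zero))
                             (dual₀-lift c′) (dual₀-lift a′))
                      (trans (xor-identityʳ (proj₁ v zero ∧ false)) (∧-zeroʳ (proj₁ v zero))))))
    (iso (lift a′) (lift c′)))
    where
    v = comb b (lift a′)
    w = comb b (lift c′)

  reduced-independent : Independent b → Isotropic b → Independent reduced
  reduced-independent ind iso a′ reduced≈0 j =
    trans (sym (pivotLift-punchIn G i₀ a′ j)) (ind (lift a′) v≈0 (punchIn i₀ j))
    where
    v = comb b (lift a′)
    w = comb b (δ i₀)
    tail≈0 : IsZero (tailᵛ v)
    tail≈0 e = trans (sym (proj₁ (comb-lift a′) e)) (proj₁ (reduced≈0 e)) ,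
               trans (sym (proj₂ (comb-lift a′) e)) (proj₂ (reduced≈0 e))
    w-dual₀ : proj₂ w zero ≡ true
    w-dual₀ = trans (⊕-δˡ (suc k) i₀ G) pivot
    -- Pairing with b i₀, whose dual 0-coordinate is 1, isolates the primal 0-coordinate of v.
    v-primal₀ : proj₁ v zero ≡ false
    v-primal₀ = begin
      proj₁ v zero
        ≡⟨ sym (∧-identityʳ _) ⟩
      proj₁ v zero ∧ true
        ≡⟨ cong (proj₁ v zero ∧_) (sym w-dual₀) ⟩
      proj₁ v zero ∧ proj₂ w zero
        ≡⟨ sym (xor-identityʳ _) ⟩
      (proj₁ v zero ∧ proj₂ w zero) xor (false ∧ proj₁ w zero)
        ≡⟨ cong (λ x → (proj₁ v zero ∧ proj₂ w zero) xor (x ∧ proj₁ w zero)) (sym (dual₀-lift a′)) ⟩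
      form₀ v w
        ≡⟨ sym (xor-identityʳ _) ⟩
      form₀ v w xor false
        ≡⟨ cong (form₀ v w xor_) (sym (form-zeroˡ (tailᵛ v) (tailᵛ w) tail≈0)) ⟩
      form v w
        ≡⟨ iso (lift a′) (δ i₀) ⟩
      false
        ∎
      where open ≡-Reasoning
    v≈0 : IsZero v
    v≈0 zero    = v-primal₀ , dual₀-lift a′
    v≈0 (suc e) = tail≈0 e

  transversal-lift : ∀ Y → Transversal Y reduced → Transversal (false ∷ Y) b
  transversal-lift Y transversal a Ya≗0 = ≗-via-punchIn i₀ a-pivot a′≗0
    where
    a′ = a ∘ punchIn i₀
    a-pivot-value : a i₀ ≡ pivotValue G i₀ a′
    a-pivot-value = xor≡false⇒≡ _ _ (trans (sym (·-pivot G a i₀ pivot)) (trans (·-comm G a) (Ya≗0 zero)))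
    a≗lift : ∀ i → a i ≡ lift a′ i
    a≗lift = ≗-via-punchIn i₀ (trans a-pivot-value (sym (insertAt-lookup a′ i₀ _)))
                              (λ c → sym (pivotLift-punchIn G i₀ a′ c))
    a′≗0 : Vanishes a′
    a′≗0 = transversal a′ λ e →
      trans (projY-cong Y (comb-lift a′) e)
            (trans (sym (projY-cong (false ∷ Y) (comb-cong b a≗lift) (suc e))) (Ya≗0 (suc e)))
    a-pivot : a i₀ ≡ false
    a-pivot = trans a-pivot-value (trans (·-congʳ (G ∘ punchIn i₀) a′≗0) (⊕-vanishes k (λ c → ∧-zeroʳ _)))

transversal-dual-pivot : ∀ {m k} → TransversalExists m → (b : Family k (suc m)) (i₀ : Fin k) →
  proj₂ (b i₀) zero ≡ true → Independent b → Isotropic b →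
  Σ (Fin (suc m) → Bool) λ Y → Transversal Y b
transversal-dual-pivot {k = suc k} ih b i₀ pivot ind iso =
  let Y , transversal = ih reduced (reduced-independent ind iso) (reduced-isotropic iso)
  in false ∷ Y , transversal-lift Y transversal
  where open DualPivotReduction b i₀ pivot

swap₀ : ∀ {m} → V (suc m) → V (suc m)
swap₀ (x , x') = (x' zero ∷ x ∘ suc) , (x zero ∷ x' ∘ suc)

-- Exchanging e₀ and e₀^∨ preserves the form (char 2) and exchanges the roles of
-- e₀ ∈ Y and e₀ ∉ Y, reducing a primal pivot to a dual one.
transversal-primal-pivot : ∀ {m k} → TransversalExists m → (b : Family k (suc m)) (i₀ : Fin k) →
  proj₁ (b i₀) zero ≡ true → Independent b → Isotropic b →
  Σ (Fin (suc m) → Bool) λ Y → Transversal Y b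
transversal-primal-pivot ih b i₀ pivot ind iso =
  let Y , transversal = transversal-dual-pivot ih (swap₀ ∘ b) i₀ pivot ind′ iso′
  in not (Y zero) ∷ Y ∘ suc , λ a Ya≗0 → transversal a λ
       { zero    → trans (sym (Bool.if-not (Y zero))) (Ya≗0 zero)
       ; (suc e) → Ya≗0 (suc e) }
  where
  ind′ : Independent (swap₀ ∘ b)
  ind′ a swapped≈0 = ind a λ
    { zero    → proj₂ (swapped≈0 zero) , proj₁ (swapped≈0 zero)
    ; (suc e) → swapped≈0 (suc e) }
  iso′ : Isotropic (swap₀ ∘ b)
  iso′ a c = trans (cong (_xor form (tailᵛ v) (tailᵛ w))
                         (xor-comm (proj₂ v zero ∧ proj₁ w zero) (proj₁ v zero ∧ proj₂ w zero)))
                   (iso a c)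
    where
    v = comb b a
    w = comb b c

transversal-exists : ∀ m → TransversalExists m
transversal-exists zero    b ind iso = (λ ()) , λ a _ → ind a (λ ())
transversal-exists (suc m) b ind iso
  with someTrue? (λ i → proj₂ (b i) zero) | someTrue? (λ i → proj₁ (b i) zero)
... | inj₁ (i₀ , pivot) | _                 =
  transversal-dual-pivot (transversal-exists m) b i₀ pivot ind iso
... | inj₂ _            | inj₁ (i₀ , pivot) =
  transversal-primal-pivot (transversal-exists m) b i₀ pivot ind iso
... | inj₂ dual₀≗0      | inj₂ primal₀≗0    =
  transversal-coordinate₀-unused (transversal-exists m) b primal₀≗0 dual₀≗0 ind iso

-- The graph of a Lagrangian

projMatrix : ∀ {k m} → (Fin m → Bool) → Family k m → Matrix m k
projMatrix Y b e i = projY Y (b i) e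

projY-comb : ∀ {k m} (Y : Fin m → Bool) (b : Family k m) a e → projY Y (comb b a) e ≡ (projMatrix Y b *ᵛ a) e
projY-comb Y b a e = trans (if-· (Y e)) (·-comm a (λ i → projY Y (b i) e))
  where
  if-· : ∀ y → (if y then a · (λ i → proj₁ (b i) e) else a · (λ i → proj₂ (b i) e))
             ≡ a · (λ i → if y then proj₁ (b i) e else proj₂ (b i) e)
  if-· true  = refl
  if-· false = refl

projY-relative : ∀ {m} (Y Y₀ : Fin m → Bool) v e →
  projY Y v e ≡ (if Y e xor Y₀ e then projY (not ∘ Y₀) v e else projY Y₀ v e)
projY-relative Y Y₀ (x , x') e = relative (Y e) (Y₀ e)
  where
  relative : ∀ y y₀ → (if y then x e else x' e) ≡
    (if y xor y₀ then (if not y₀ then x e else x' e) else (if y₀ then x e else x' e))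
  relative true  true  = refl
  relative true  false = refl
  relative false true  = refl
  relative false false = refl

form-projY : ∀ {m} (Y : Fin m → Bool) v w →
  form v w ≡ ⊕ m (λ e → (projY (not ∘ Y) v e ∧ projY Y w e) xor (projY Y v e ∧ projY (not ∘ Y) w e))
form-projY {m} Y (x , x') (y , y') = ⊕-cong m (λ e → pairing (Y e) e)
  where
  pairing : ∀ t e → (x e ∧ y' e) xor (x' e ∧ y e) ≡
    ((if not t then x e else x' e) ∧ (if t then y e else y' e)) xor
    ((if t then x e else x' e) ∧ (if not t then y e else y' e))
  pairing true  e = xor-comm (x e ∧ y' e) (x' e ∧ y e)
  pairing false e = refl

inSpan⇔projY-vanishes : ∀ {n} (Y : Subset n) v → InSpanYdualCompl Y v ⇔ Vanishes (projY (lookup Y) v)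
inSpan⇔projY-vanishes Y (x , x') = mk⇔ (λ inSpan e → to (lookup Y e) (inSpan e))
                                       (λ proj≗0 e → from (lookup Y e) (proj≗0 e))
  where
  to : ∀ {e} y → (if y then x e ≡ false else x' e ≡ false) → (if y then x e else x' e) ≡ false
  to true  p = p
  to false p = p
  from : ∀ {e} y → (if y then x e else x' e) ≡ false → (if y then x e ≡ false else x' e ≡ false)
  from true  p = p
  from false p = p

Δ-involutive : ∀ {n} (U W : Subset n) → (U Δ W) Δ W ≡ U
Δ-involutive Vec.[]       Vec.[]       = refl
Δ-involutive (u Vec.∷ U) (w Vec.∷ W) = cong₂ Vec._∷_ (xor-cancelʳ u w) (Δ-involutive U W)

module LagrangianGraph {n} (L : Lagrangian n) where
  open Lagrangian L

  Y₀ : Fin n → Bool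
  Y₀ = proj₁ (transversal-exists n basis independent isotropic)

  Q P : Square n
  Q = projMatrix Y₀ basis
  P = projMatrix (not ∘ Y₀) basis

  Q-trivialKernel : TrivialKernel Q
  Q-trivialKernel a Qa≗0 =
    proj₂ (transversal-exists n basis independent isotropic) a (λ e → trans (projY-comb Y₀ basis a e) (Qa≗0 e))

  Q⁻¹ : Square n
  Q⁻¹ i d = proj₁ (trivialKernel⇒onto n Q Q-trivialKernel (λ e → δ e d)) i

  Q*Q⁻¹≗identity : ∀ e d → (Q *ᴹ Q⁻¹) e d ≡ identity e d
  Q*Q⁻¹≗identity e d = proj₂ (trivialKernel⇒onto n Q Q-trivialKernel (λ e → δ e d)) e

  Q-Q⁻¹ : ∀ z e → (Q *ᵛ (Q⁻¹ *ᵛ z)) e ≡ z e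
  Q-Q⁻¹ z e = trans (sym (*ᵛ-assoc Q Q⁻¹ z e))
                    (trans (*ᵛ-congˡ Q*Q⁻¹≗identity z e) (*ᵛ-identity z e))

  Q⁻¹-Q : ∀ a i → (Q⁻¹ *ᵛ (Q *ᵛ a)) i ≡ a i
  Q⁻¹-Q a i = sym (xor≡false⇒≡ _ _ (Q-trivialKernel (a +ᵛ (Q⁻¹ *ᵛ (Q *ᵛ a))) (λ e →
    trans (*ᵛ-+ᵛ Q a (Q⁻¹ *ᵛ (Q *ᵛ a)) e)
          (trans (cong ((Q *ᵛ a) e xor_) (Q-Q⁻¹ (Q *ᵛ a) e)) (xor-same ((Q *ᵛ a) e)))) i))

  A : Square n
  A = P *ᴹ Q⁻¹

  P≗A*Q : ∀ a e → (P *ᵛ a) e ≡ (A *ᵛ (Q *ᵛ a)) e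
  P≗A*Q a e = trans (sym (·-congʳ (P e) (Q⁻¹-Q a))) (sym (*ᵛ-assoc P Q⁻¹ (Q *ᵛ a) e))

  A-symmetric : ∀ d d′ → A d d′ ≡ A d′ d
  A-symmetric d d′ = xor≡false⇒≡ _ _ (begin
    A d d′ xor A d′ d
      ≡⟨ xor-comm (A d d′) (A d′ d) ⟩
    A d′ d xor A d d′
      ≡⟨ sym (cong₂ _xor_ (⊕-δʳ n d′ (λ e → A e d)) (⊕-δˡ n d (λ e → A e d′))) ⟩
    ⊕ n (λ e → A e d ∧ δ e d′) xor ⊕ n (λ e → δ d e ∧ A e d′)
      ≡⟨ sym (⊕-distrib-xor n (λ e → A e d ∧ δ e d′) (λ e → δ d e ∧ A e d′)) ⟩
    ⊕ n (λ e → (A e d ∧ δ e d′) xor (δ d e ∧ A e d′))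
      ≡⟨ ⊕-cong n (λ e → sym (cong₂ (λ x y → (A e d ∧ x) xor (y ∧ A e d′))
                                    (Q-column d′ e) (trans (Q-column d e) (δ-sym e d)))) ⟩
    ⊕ n (λ e → ((P *ᵛ column Q⁻¹ d) e ∧ (Q *ᵛ column Q⁻¹ d′) e) xor
               ((Q *ᵛ column Q⁻¹ d) e ∧ (P *ᵛ column Q⁻¹ d′) e))
      ≡⟨ sym (⊕-cong n (λ e → cong₂ _xor_
           (cong₂ _∧_ (projY-comb (not ∘ Y₀) basis (column Q⁻¹ d) e) (projY-comb Y₀ basis (column Q⁻¹ d′) e))
           (cong₂ _∧_ (projY-comb Y₀ basis (column Q⁻¹ d) e) (projY-comb (not ∘ Y₀) basis (column Q⁻¹ d′) e)))) ⟩
    ⊕ n (λ e → (projY (not ∘ Y₀) v e ∧ projY Y₀ w e) xor (projY Y₀ v e ∧ projY (not ∘ Y₀) w e))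
      ≡⟨ sym (form-projY Y₀ v w) ⟩
    form v w
      ≡⟨ isotropic (column Q⁻¹ d) (column Q⁻¹ d′) ⟩
    false
      ∎)
    where
    open ≡-Reasoning
    v = comb basis (column Q⁻¹ d)
    w = comb basis (column Q⁻¹ d′)
    Q-column : ∀ d e → (Q *ᵛ column Q⁻¹ d) e ≡ δ e d
    Q-column d e = Q*Q⁻¹≗identity e d

  graph : FramedGraph n
  graph = record { adj = A ; sym = A-symmetric }

  InΨ⇔transversal : ∀ Y → InΨ L Y ⇔ Transversal (lookup Y) basis
  InΨ⇔transversal Y = mk⇔
    (λ Y∈Ψ a proj≗0 → independent a (Y∈Ψ a (Equivalence.from (inSpan⇔projY-vanishes Y (comb basis a)) proj≗0)))
    (λ transversal a inSpan →
      comb-vanishes basis (transversal a (Equivalence.to (inSpan⇔projY-vanishes Y (comb basis a)) inSpan)))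

  transversal⇔trivialKernelOn : ∀ Y φ → (∀ e → φ e ≡ Y e xor Y₀ e) →
    Transversal Y basis ⇔ TrivialKernelOn A φ
  transversal⇔trivialKernelOn Y φ φ≗Y+Y₀ = mk⇔ to from
    where
    on : ∀ a e → φ e ≡ true → projY Y (comb basis a) e ≡ (A *ᵛ (Q *ᵛ a)) e
    on a e φe = trans (projY-relative Y Y₀ (comb basis a) e)
      (trans (cong (if_then projY (not ∘ Y₀) (comb basis a) e else projY Y₀ (comb basis a) e)
                   (trans (sym (φ≗Y+Y₀ e)) φe))
             (trans (projY-comb (not ∘ Y₀) basis a e) (P≗A*Q a e)))
    off : ∀ a e → φ e ≡ false → projY Y (comb basis a) e ≡ (Q *ᵛ a) e
    off a e φe = trans (projY-relative Y Y₀ (comb basis a) e)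
      (trans (cong (if_then projY (not ∘ Y₀) (comb basis a) e else projY Y₀ (comb basis a) e)
                   (trans (sym (φ≗Y+Y₀ e)) φe))
             (projY-comb Y₀ basis a e))
    to : Transversal Y basis → TrivialKernelOn A φ
    to transversal z z-supported Az≗0 e = trans (sym (Q-Q⁻¹ z e)) (*ᵛ-vanishes Q (transversal a proj≗0) e)
      where
      a = Q⁻¹ *ᵛ z
      proj≗0 : Vanishes (projY Y (comb basis a))
      proj≗0 e with φ e in φe
      ... | true  = trans (on a e φe) (trans (·-congʳ (A e) (Q-Q⁻¹ z)) (Az≗0 e φe))
      ... | false = trans (off a e φe) (trans (Q-Q⁻¹ z e) (z-supported e φe))
    from : TrivialKernelOn A φ → Transversal Y basis
    from trivial a proj≗0 = Q-trivialKernel a (trivial (Q *ᵛ a)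
      (λ e φe → trans (sym (off a e φe)) (proj≗0 e))
      (λ e φe → trans (sym (on a e φe)) (proj≗0 e)))

  E′ : Subset n
  E′ = tabulate Y₀

  InΨ⇔InΦ : ∀ Y → InΨ L Y ⇔ InΦ graph (Y Δ E′)
  InΨ⇔InΦ Y =
    ⇔.trans (InΨ⇔transversal Y)
    (⇔.trans (transversal⇔trivialKernelOn (lookup Y) (lookup (Y Δ E′)) (λ e →
               trans (lookup-zipWith _xor_ e Y E′) (cong (lookup Y e xor_) (lookup∘tabulate Y₀ e))))
    (⇔.trans (trivialKernelOn⇔trivialKernel (elems-enumeration (Y Δ E′)) A)
             (⇔.sym (det≡true⇔trivialKernel _ (inducedMatrix graph (Y Δ E′))))))

corollary2p1 : (n : ℕ) → (L : Lagrangian n) → IsBinaryDeltaMatroid (InΨ L)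
corollary2p1 n L = graph , E′ , λ Y → mk⇔
  (λ Y∈Ψ → Y Δ E′ , Equivalence.to (InΨ⇔InΦ Y) Y∈Ψ , sym (Δ-involutive Y E′))
  (λ { (φ , φ∈Φ , refl) →
        Equivalence.from (InΨ⇔InΦ (φ Δ E′)) (subst (InΦ graph) (sym (Δ-involutive φ E′)) φ∈Φ) })
  where open LagrangianGraph L
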